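{- Let $l\ge17$ be a prime and $m=4-3l^2$. Let $\omega_1,\omega_2,\omega_3\in\mathbb{Z}_{\ge2}\cup\{\infty\}$ with (at least) one $\omega_i$ finite. If $-3$ is a square modulo $84+l^2$, then $(\mathcal{X}_m,\mathcal{D}_{\underline\omega})^*_{\mathrm{str}}(\mathbb{Z})\ne\emptyset$ (for both Campana and Darmon points).
   Context: $U_m\subset\mathbb{A}^3_{\mathbb{Q}}$ is $u_1^2+u_2^2+u_3^2-u_1u_2u_3=m$; $\mathcal{X}_m\subset\mathbb{P}^3_{\mathbb{Z}}$ is $x_0(x_1^2+x_2^2+x_3^2)-x_1x_2x_3=mx_0^3$ with generic fibre $X_m$, $U_m=X_m\cap\{x_0\ne0\}$ via $u_j=x_j/x_0$. $D_j=\{x_0=x_j=0\}$, $\mathcal{D}_j$ its closure in $\mathcal{X}_m$, $\mathcal{D}_{\underline\omega}=\sum(1-1/\omega_j)\mathcal{D}_j$, $\mathcal{D}_{\inf}=\bigcup_{\omega_j=\infty}\mathcal{D}_j$. For a prime $p$ and $M_p\in\mathcal{X}_m(\mathbb{Z}_p)$, write $\mathrm{Spec}\,\mathbb{Z}_p\times_{\mathcal{X}_m}\mathcal{D}_j=\mathrm{Spec}(\mathbb{Z}_p/I)$, $n_p(\mathcal{D}_j,M_p)=\infty$ if $I=0$, $=n$ if $I=(p^n)$. $(\mathcal{X}_m,\mathcal{D}_{\underline\omega})^*_{\mathrm{str}}(\mathbb{Z})$ is the set of $M\in U_m(\mathbb{Q})$ such that for every prime $p$, $M\in(\mathcal{X}_m\setminus\mathcal{D}_{\inf})(\mathbb{Z}_p)$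 and for every $j$ with $\omega_j<\infty$, $n_p(\mathcal{D}_j,M)\in\mathbb{Z}_{\ge\omega_j}\cup\{0,\infty\}$ (Campana) resp. $\in\omega_j\mathbb{Z}_{\ge0}\cup\{\infty\}$ (Darmon). -}

module Defs where

open import Data.Nat as ℕ using (ℕ; zero; suc; _≤_)
open import Data.Nat.Primality using (Prime)
open import Data.Nat.Divisibility as ℕD using ()
open import Data.Integer as ℤ using (ℤ; +_; ∣_∣)
open import Data.Integer.Divisibility as ℤD using ()
open import Data.Product using (_×_; Σ; ∃; _,_)
open import Data.Sum using (_⊎_)
open import Relation.Nullary using (¬_)
open import Relation.Binary.PropositionalEquality using (_≡_; _≢_)

data Weight : Set where
  fin : ℕ → Weight
  ∞   : Weight

data AdmissibleWeight : Weight → Set where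
  fin-ok : ∀ {ω} → 2 ≤ ω → AdmissibleWeight (fin ω)
  ∞-ok   : AdmissibleWeight ∞

data IsFinite : Weight → Set where
  is-fin : ∀ ω → IsFinite (fin ω)

data Kind : Set where
  campana darmon : Kind

record Quad : Set where
  constructor quad
  field
    x0 x1 x2 x3 : ℤ
open Quad public

coord : Quad → (j : ℕ) → ℤ
coord M 0 = x1 M
coord M 1 = x2 M
coord M _ = x3 M

-- primitive integral representative of a point of P^3(ℚ)
Primitive : Quad → Set
Primitive M = ∀ p → Prime p →
  ¬ (p ℕD.∣ ∣ x0 M ∣ × p ℕD.∣ ∣ x1 M ∣ × p ℕD.∣ ∣ x2 M ∣ × p ℕD.∣ ∣ x3 M ∣)

mOf : ℕ → ℤ
mOf l = + 4 ℤ.- (+ 3 ℤ.* (+ l ℤ.* + l))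

OnX : ℤ → Quad → Set
OnX m (quad a b c d) =
  a ℤ.* (b ℤ.* b ℤ.+ c ℤ.* c ℤ.+ d ℤ.* d) ℤ.- b ℤ.* c ℤ.* d ≡ m ℤ.* (a ℤ.* a ℤ.* a)

-- For the Z_p-point M (primitive coordinates) the pullback of
-- D_j = {x0 = xj = 0} is Spec Z_p/(x0, xj); "n_p(D_j,M) = n" means (x0,xj) = (p^n),
-- i.e. p^n divides both and p^(n+1) does not divide both.
IsNp : ℕ → Quad → ℕ → ℕ → Set
IsNp p M j n =
  ((p ℕ.^ n) ℕD.∣ ∣ x0 M ∣ × (p ℕ.^ n) ℕD.∣ ∣ coord M j ∣)
  × ¬ ((p ℕ.^ suc n) ℕD.∣ ∣ x0 M ∣ × (p ℕ.^ suc n) ℕD.∣ ∣ coord M j ∣)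

MultOK : Kind → ℕ → ℕ → Set
MultOK campana ω n = n ≡ 0 ⊎ ω ≤ n
MultOK darmon  ω n = ω ℕD.∣ n

-- local condition at D_j for weight ω (∞ : M ∉ D_j over Z_p, i.e. n_p = 0)
LocalOK : Kind → ℕ → Quad → ℕ → Weight → Set
LocalOK k p M j ∞       = ∀ n → IsNp p M j n → n ≡ 0
LocalOK k p M j (fin ω) = ∀ n → IsNp p M j n → MultOK k ω n

-- M = [x0:x1:x2:x3] with x0 ≠ 0 (so M ∈ U_m(Q), u_j = x_j/x0) is in (X_m, D_ω)^*_str(Z)
IsStrictPoint : Kind → ℤ → (Weight × Weight × Weight) → Quad → Set
IsStrictPoint k m (ω₁ , ω₂ , ω₃) M =
  x0 M ≢ + 0 × Primitive M × OnX m M ×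
  (∀ p → Prime p → LocalOK k p M 0 ω₁ × LocalOK k p M 1 ω₂ × LocalOK k p M 2 ω₃)

{-# OPTIONS --safe #-}
-- Put N = 84 + l². Since −3 and −84 are squares modulo N and 6 is invertible modulo N, 7 is a
-- square modulo N, so N is the first coefficient of a binary form of determinant 7. Reducing such
-- forms shows N = ±(u² − 7v²), and the sign − is impossible because −1 is not a square modulo 7
-- and 7 ∤ l. Multiplying u + v√7 by 2 − √7 and then j times by 11 − 4√7 gives a + b√7 of norm
-- −3N·9ʲ with 3 ∤ b. The point [3ʲ⁺¹ : 16·3ʲ⁺¹ : 8b − 3a : b] lies on X_m; as x₀ is a power of 3
-- while 3 divides neither 8b − 3a nor b, it meets D₁ with multiplicity exactly j + 1 at p = 3 and
-- nowhere else, and never meets D₂ or D₃. Choosing j + 1 = ω₁, and permuting x₁, x₂, x₃ when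
-- another weight is the finite one, gives a point that is both Campana and Darmon.

module Submission where

open import Defs
open import Data.Nat as ℕ using (ℕ; _≤_)
open import Data.Nat.Primality using (Prime)
open import Data.Integer as ℤ using (ℤ; +_)
open import Data.Integer.Divisibility as ℤD using ()
open import Data.Product using (_×_; Σ; ∃; _,_)
open import Data.Sum using (_⊎_)

open import Data.Nat using (zero; suc; z≤n; s≤s)
import Data.Nat.Properties as ℕP
import Data.Nat.Divisibility as ℕD
open import Data.Nat.DivMod using (m≡m%n+[m/n]*n; m%n<n)
open import Data.Nat.Primality
  using (prime?; euclidsLemma; prime⇒irreducible; prime⇒nonTrivial; prime⇒nonZero; composite)
import Data.Nat.Tactic.RingSolver as ℕRing
open import Data.Integer using (-[1+_]; ∣_∣; _+_; _*_; _-_; -_; _⊖_; 0ℤ; 1ℤ; -1ℤ; NonZero; ≢-nonZero)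
import Data.Integer.Properties as ℤP
open import Data.Integer.DivMod using (_/_; _%_; _/ℕ_; _%ℕ_; a≡a%n+[a/n]*n; n%d<d; a≡a%ℕn+[a/ℕn]*n; n%ℕd<d)
open import Data.Integer.Divisibility.Signed
  using (_∣_; divides; _∣?_; ∣ᵤ⇒∣; ∣⇒∣ᵤ; ∣-refl; ∣m∣n⇒∣m+n; ∣m∣n⇒∣m-n; ∣m+n∣n⇒∣m; ∣n⇒∣m*n)
open import Data.Integer.Tactic.RingSolver using (solve)
open import Data.List using (_∷_; [])
open import Data.Product using (∃₂)
import Data.Product as Prod
open import Data.Sum using (inj₁; inj₂; [_,_]′)
import Data.Sum as Sum
open import Data.Empty using (⊥-elim)
open import Function using (_∘_; id)
open import Induction.WellFounded using (Acc; acc)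
open import Data.Nat.Induction using (<-wellFounded)
open import Relation.Nullary using (¬_; yes; no; contradiction)
open import Relation.Nullary.Decidable using (from-yes; from-no; _→-dec_)
open import Relation.Binary.Definitions using (tri<; tri≈; tri>)
open import Relation.Binary.PropositionalEquality
open ≡-Reasoning

i*i≡∣i∣*∣i∣ : ∀ i → i * i ≡ + (∣ i ∣ ℕ.* ∣ i ∣)
i*i≡∣i∣*∣i∣ (+ n)    = sym (ℤP.pos-* n n)
i*i≡∣i∣*∣i∣ -[1+ n ] = sym (ℤP.pos-* (suc n) (suc n))

even⊎odd : ∀ b → ∃ λ q → b ≡ q * + 2 ⊎ b ≡ + 1 + q * + 2
even⊎odd b with b %ℕ 2 | a≡a%ℕn+[a/ℕn]*n b 2 | n%ℕd<d b 2
... | 0           | b≡ | _ = b /ℕ 2 , inj₁ (trans b≡ (ℤP.+-identityˡ _))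
... | 1           | b≡ | _ = b /ℕ 2 , inj₂ b≡
... | suc (suc _) | _  | s≤s (s≤s ())

7∣r²+s²⇒r≡0 : ∀ {r} → r ℕ.< 7 → ∀ {s} → s ℕ.< 7 → + 7 ∣ + r * + r + + s * + s → r ≡ 0
7∣r²+s²⇒r≡0 = from-yes (ℕP.allUpTo? (λ r → ℕP.allUpTo? (λ s →
  (+ 7 ∣? + r * + r + + s * + s) →-dec (r ℕP.≟ 0)) 7) 7)

7∣x²+y²⇒7∣x : ∀ x y → + 7 ∣ x * x + y * y → + 7 ∣ x
7∣x²+y²⇒7∣x x y 7∣x²+y² = divides (x /ℕ 7) (begin
  x                          ≡⟨ a≡a%ℕn+[a/ℕn]*n x 7 ⟩
  + r + x /ℕ 7 * + 7         ≡⟨ cong (λ r → + r + x /ℕ 7 * + 7) r≡0 ⟩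
  + 0 + x /ℕ 7 * + 7         ≡⟨ ℤP.+-identityˡ _ ⟩
  x /ℕ 7 * + 7               ∎)
  where
  r s : ℕ
  r = x %ℕ 7
  s = y %ℕ 7
  7∣r²+s² : + 7 ∣ + r * + r + + s * + s
  7∣r²+s² = residues (+ r) (+ s) (x /ℕ 7) (y /ℕ 7)
    (subst (λ (u , v) → + 7 ∣ u * u + v * v) (cong₂ _,_ (a≡a%ℕn+[a/ℕn]*n x 7) (a≡a%ℕn+[a/ℕn]*n y 7)) 7∣x²+y²)
    where
    residues : ∀ r s X Y → + 7 ∣ (r + X * + 7) * (r + X * + 7) + (s + Y * + 7) * (s + Y * + 7) →
               + 7 ∣ r * r + s * s
    residues r s X Y 7∣ =
      ∣m+n∣n⇒∣m (subst (+ 7 ∣_) expand 7∣) (∣n⇒∣m*n (X * (+ 2 * r + X * + 7) + Y * (+ 2 * s + Y * + 7)) ∣-refl)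
      where
      expand : (r + X * + 7) * (r + X * + 7) + (s + Y * + 7) * (s + Y * + 7)
             ≡ (r * r + s * s) + (X * (+ 2 * r + X * + 7) + Y * (+ 2 * s + Y * + 7)) * + 7
      expand = solve (r ∷ s ∷ X ∷ Y ∷ [])
  r≡0 : r ≡ 0
  r≡0 = 7∣r²+s²⇒r≡0 (n%ℕd<d x 7) (n%ℕd<d y 7) 7∣r²+s²

b²≢7 : ∀ b → b * b ≢ + 7
b²≢7 b b²≡7 with 7∣x²+y²⇒7∣x b 0ℤ (divides 1ℤ (trans (ℤP.+-identityʳ (b * b)) b²≡7))
... | divides q refl = from-no (+ 49 ∣? + 7) (divides (q * q) (begin
  + 7                  ≡⟨ b²≡7 ⟨
  q * + 7 * (q * + 7)  ≡⟨ solve (q ∷ []) ⟩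
  q * q * + 49         ∎))

-- The binary form aX² + 2bXY + cY² equals σ((pX + qY)² − D(sX + tY)²).
record NormPullback (D σ a b c : ℤ) : Set where
  constructor pullback
  field
    p q s t : ℤ
    a≡ : a ≡ σ * (p * p - D * (s * s))
    b≡ : b ≡ σ * (p * q - D * (s * t))
    c≡ : c ≡ σ * (q * q - D * (t * t))

NormPullback± : ℤ → ℤ → ℤ → ℤ → Set
NormPullback± D a b c = NormPullback D 1ℤ a b c ⊎ NormPullback D -1ℤ a b c

NormPullback-negate : ∀ {D σ a b c} → NormPullback D σ (- a) (- b) (- c) → NormPullback D (- σ) a b c
NormPullback-negate {σ = σ} (pullback p q s t a≡ b≡ c≡) = pullback p q s t (flip a≡) (flip b≡) (flip c≡)
  where
  flip : ∀ {x y} → - x ≡ σ * y → x ≡ - σ * y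
  flip {x} {y} -x≡ = trans (sym (ℤP.neg-involutive x)) (trans (cong -_ -x≡) (ℤP.neg-distribˡ-* σ y))

NormPullback±-negate : ∀ {D a b c} → NormPullback± D (- a) (- b) (- c) → NormPullback± D a b c
NormPullback±-negate (inj₁ f) = inj₂ (NormPullback-negate f)
NormPullback±-negate (inj₂ f) = inj₁ (NormPullback-negate f)

-- (c − 2bK + aK², aK − b, a) is the form (a, b, c) after the substitution (X, Y) ↦ (KX + Y, −X).
NormPullback-shift : ∀ {D σ a b c} K → NormPullback D σ (c - + 2 * b * K + a * K * K) (a * K - b) a →
                     NormPullback D σ a b c
NormPullback-shift {D} {σ} {a} {b} {c} K (pullback p q s t a'≡ b'≡ a≡) =
  pullback q (q * K - p) t (t * K - s) a≡ b≡ c≡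
  where
  b≡ : b ≡ σ * (q * (q * K - p) - D * (t * (t * K - s)))
  b≡ = begin
    b                                                            ≡⟨ solve (a ∷ b ∷ K ∷ []) ⟩
    a * K - (a * K - b)                                          ≡⟨ cong₂ (λ x y → x * K - y) a≡ b'≡ ⟩
    σ * (q * q - D * (t * t)) * K - σ * (p * q - D * (s * t))    ≡⟨ solve (D ∷ σ ∷ p ∷ q ∷ s ∷ t ∷ K ∷ []) ⟩
    σ * (q * (q * K - p) - D * (t * (t * K - s)))                ∎
  c≡ : c ≡ σ * ((q * K - p) * (q * K - p) - D * ((t * K - s) * (t * K - s)))
  c≡ =
    let a' = c - + 2 * b * K + a * K * K
        b' = a * K - b
        P  = p * p - D * (s * s)
        B  = p * q - D * (s * t)
        C  = q * q - D * (t * t)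
    in begin
      c                                           ≡⟨ solve (a ∷ b ∷ c ∷ K ∷ []) ⟩
      a' + a * K * K - + 2 * K * b'               ≡⟨ cong₂ (λ x y → x + a * K * K - + 2 * K * y) a'≡ b'≡ ⟩
      σ * P + a * K * K - + 2 * K * (σ * B)       ≡⟨ cong (λ x → σ * P + x * K * K - + 2 * K * (σ * B)) a≡ ⟩
      σ * P + σ * C * K * K - + 2 * K * (σ * B)   ≡⟨ solve (D ∷ σ ∷ p ∷ q ∷ s ∷ t ∷ K ∷ []) ⟩
      σ * ((q * K - p) * (q * K - p) - D * ((t * K - s) * (t * K - s))) ∎

∣a*[b/a]-b∣<∣a∣ : ∀ a b .{{_ : NonZero a}} → ∣ a * (b / a) - b ∣ ℕ.< ∣ a ∣
∣a*[b/a]-b∣<∣a∣ a b = subst (ℕ._< ∣ a ∣) (sym ∣a*[b/a]-b∣≡b%a) (n%d<d b a)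
  where
  ∣a*[b/a]-b∣≡b%a : ∣ a * (b / a) - b ∣ ≡ b % a
  ∣a*[b/a]-b∣≡b%a = begin
    ∣ a * (b / a) - b ∣                     ≡⟨ cong (λ x → ∣ a * (b / a) - x ∣) (a≡a%n+[a/n]*n b a) ⟩
    ∣ a * (b / a) - (+ (b % a) + b / a * a) ∣ ≡⟨ cong ∣_∣ (cancel (b / a) (+ (b % a))) ⟩
    ∣ - + (b % a) ∣                          ≡⟨ ℤP.∣-i∣≡∣i∣ (+ (b % a)) ⟩
    b % a                                    ∎
    where
    cancel : ∀ Q R → a * Q - (R + Q * a) ≡ - R
    cancel Q R = solve (a ∷ Q ∷ R ∷ [])

∣a'∣<∣a∣ : ∀ (D : ℕ) {a a' b'} → a * a' ≡ b' * b' - + D → ∣ b' ∣ ℕ.< ∣ a ∣ → D ℕ.< ∣ a ∣ ℕ.* ∣ a ∣ →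
           ∣ a' ∣ ℕ.< ∣ a ∣
∣a'∣<∣a∣ D {a} {a'} {b'} aa'≡ b'<a D<a² = ℕP.*-cancelˡ-< (∣ a ∣) (∣ a' ∣) (∣ a ∣)
  (subst (ℕ._< ∣ a ∣ ℕ.* ∣ a ∣) (sym ∣aa'∣≡)
    (ℕP.≤-<-trans (ℤP.∣m⊝n∣≤m⊔n B² D) (ℕP.⊔-lub (ℕP.*-mono-< b'<a b'<a) D<a²)))
  where
  B² : ℕ
  B² = ∣ b' ∣ ℕ.* ∣ b' ∣
  ∣aa'∣≡ : ∣ a ∣ ℕ.* ∣ a' ∣ ≡ ∣ B² ⊖ D ∣
  ∣aa'∣≡ = begin
    ∣ a ∣ ℕ.* ∣ a' ∣  ≡⟨ ℤP.abs-* a a' ⟨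
    ∣ a * a' ∣        ≡⟨ cong ∣_∣ (trans aa'≡ (cong (_- + D) (i*i≡∣i∣*∣i∣ b'))) ⟩
    ∣ + B² - + D ∣    ≡⟨ cong ∣_∣ (ℤP.m-n≡m⊖n B² D) ⟩
    ∣ B² ⊖ D ∣        ∎

small⁺⇒NormPullback± : ∀ n {b c} → n ℕ.≤ 2 → b * b - + n * c ≡ + 7 → NormPullback± (+ 7) (+ n) b c
small⁺⇒NormPullback± 0 {b} {c} _ disc = ⊥-elim (b²≢7 b (begin
  b * b              ≡⟨ solve (b ∷ c ∷ []) ⟩
  b * b - + 0 * c    ≡⟨ disc ⟩
  + 7                ∎))
small⁺⇒NormPullback± 1 {b} {c} _ disc = inj₁ (pullback 1ℤ b 0ℤ 1ℤ refl (solve (b ∷ [])) (begin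
  c                                   ≡⟨ solve (b ∷ c ∷ []) ⟩
  b * b - (b * b - + 1 * c)           ≡⟨ cong (λ x → b * b - x) disc ⟩
  b * b - + 7                         ≡⟨ solve (b ∷ []) ⟩
  1ℤ * (b * b - + 7 * (1ℤ * 1ℤ))      ∎))
small⁺⇒NormPullback± 2 {b} {c} _ disc with even⊎odd b
... | q , inj₁ refl = ⊥-elim (from-no (+ 2 ∣? + 7) (divides (+ 2 * (q * q) - c) (begin
  + 7                                 ≡⟨ disc ⟨
  q * + 2 * (q * + 2) - + 2 * c       ≡⟨ solve (q ∷ c ∷ []) ⟩
  (+ 2 * (q * q) - c) * + 2           ∎)))
... | q , inj₂ refl = inj₁ (pullback (+ 3) (+ 3 * q - + 2) 1ℤ (q - 1ℤ) refl b≡ c≡)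
  where
  b≡ : + 1 + q * + 2 ≡ 1ℤ * (+ 3 * (+ 3 * q - + 2) - + 7 * (1ℤ * (q - 1ℤ)))
  b≡ = solve (q ∷ [])
  c≡ : c ≡ 1ℤ * ((+ 3 * q - + 2) * (+ 3 * q - + 2) - + 7 * ((q - 1ℤ) * (q - 1ℤ)))
  c≡ = let b = + 1 + q * + 2 in ℤP.*-cancelˡ-≡ (+ 2) c _ (begin
    + 2 * c                          ≡⟨ solve (q ∷ c ∷ []) ⟩
    b * b - (b * b - + 2 * c)        ≡⟨ cong (λ x → b * b - x) disc ⟩
    b * b - + 7                      ≡⟨ solve (q ∷ []) ⟩
    + 2 * (1ℤ * ((+ 3 * q - + 2) * (+ 3 * q - + 2) - + 7 * ((q - 1ℤ) * (q - 1ℤ)))) ∎)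
small⁺⇒NormPullback± (suc (suc (suc _))) (s≤s (s≤s ()))

small⇒NormPullback± : ∀ a {b c} → ∣ a ∣ ℕ.≤ 2 → b * b - a * c ≡ + 7 → NormPullback± (+ 7) a b c
small⇒NormPullback± (+ n)      a≤2 disc = small⁺⇒NormPullback± n a≤2 disc
small⇒NormPullback± -[1+ n ] {b} {c} a≤2 disc =
  NormPullback±-negate (small⁺⇒NormPullback± (suc n) a≤2 (trans (negated -[1+ n ] b c) disc))
  where
  negated : ∀ a b c → - b * - b - - a * - c ≡ b * b - a * c
  negated a b c = solve (a ∷ b ∷ c ∷ [])

det7⇒NormPullback± : ∀ a {b c} → b * b - a * c ≡ + 7 → NormPullback± (+ 7) a b c
det7⇒NormPullback± a = go a (<-wellFounded ∣ a ∣)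
  where
  go : ∀ a {b c} → Acc ℕ._<_ ∣ a ∣ → b * b - a * c ≡ + 7 → NormPullback± (+ 7) a b c
  go a {b} {c} (acc smaller) disc with ∣ a ∣ ℕP.≤? 2
  ... | yes a≤2 = small⇒NormPullback± a a≤2 disc
  ... | no a≰2 = Sum.map (NormPullback-shift K) (NormPullback-shift K) (go a' (smaller ∣a'∣<∣a∣') disc')
    where
    a≢0 : a ≢ 0ℤ
    a≢0 refl = a≰2 z≤n
    instance
      a-nonZero : NonZero a
      a-nonZero = ≢-nonZero a≢0
    K : ℤ
    K = b / a
    a' b' : ℤ
    a' = c - + 2 * b * K + a * K * K
    b' = a * K - b
    shift-det : ∀ K → (a * K - b) * (a * K - b) - (c - + 2 * b * K + a * K * K) * a ≡ b * b - a * c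
    shift-det K = solve (a ∷ b ∷ c ∷ K ∷ [])
    disc' : b' * b' - a' * a ≡ + 7
    disc' = trans (shift-det K) disc
    aa'≡ : a * a' ≡ b' * b' - + 7
    aa'≡ = trans (rearrange a a' (b' * b')) (cong (λ x → b' * b' - x) disc')
      where
      rearrange : ∀ x y z → x * y ≡ z - (z - y * x)
      rearrange x y z = solve (x ∷ y ∷ z ∷ [])
    7<a² : 7 ℕ.< ∣ a ∣ ℕ.* ∣ a ∣
    7<a² = ℕP.≤-trans (ℕP.n≤1+n 8) (ℕP.*-mono-≤ (ℕP.≰⇒> a≰2) (ℕP.≰⇒> a≰2))
    ∣a'∣<∣a∣' : ∣ a' ∣ ℕ.< ∣ a ∣
    ∣a'∣<∣a∣' = ∣a'∣<∣a∣ 7 {a} {a'} {b'} aa'≡ (∣a*[b/a]-b∣<∣a∣ a b) 7<a²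

coprime6⇒n²≡1[6] : ∀ n → ¬ 2 ℕD.∣ n → ¬ 3 ℕD.∣ n → ∃ λ k → n ℕ.* n ≡ 1 ℕ.+ 6 ℕ.* k
coprime6⇒n²≡1[6] n 2∤n 3∤n = byResidue (n ℕ.% 6) (n ℕ./ 6) (m%n<n n 6) (m≡m%n+[m/n]*n n 6)
  where
  byResidue : ∀ r q → r ℕ.< 6 → n ≡ r ℕ.+ q ℕ.* 6 → ∃ λ k → n ℕ.* n ≡ 1 ℕ.+ 6 ℕ.* k
  byResidue 0 q _ n≡ = contradiction (ℕD.divides (q ℕ.* 3) (trans n≡ (ℕRing.solve (q ∷ [])))) 2∤n
  byResidue 1 q _ n≡ = q ℕ.* (6 ℕ.* q ℕ.+ 2) , trans (cong₂ ℕ._*_ n≡ n≡) (ℕRing.solve (q ∷ []))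
  byResidue 2 q _ n≡ = contradiction (ℕD.divides (1 ℕ.+ q ℕ.* 3) (trans n≡ (ℕRing.solve (q ∷ [])))) 2∤n
  byResidue 3 q _ n≡ = contradiction (ℕD.divides (1 ℕ.+ q ℕ.* 2) (trans n≡ (ℕRing.solve (q ∷ [])))) 3∤n
  byResidue 4 q _ n≡ = contradiction (ℕD.divides (2 ℕ.+ q ℕ.* 3) (trans n≡ (ℕRing.solve (q ∷ [])))) 2∤n
  byResidue 5 q _ n≡ = 4 ℕ.+ q ℕ.* (6 ℕ.* q ℕ.+ 10) , trans (cong₂ ℕ._*_ n≡ n≡) (ℕRing.solve (q ∷ []))
  byResidue (suc (suc (suc (suc (suc (suc _)))))) _ (s≤s (s≤s (s≤s (s≤s (s≤s (s≤s ())))))) _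

-- x² ≡ −3, y² ≡ −84 and 6W ≡ −1 (mod N) give (xyW)² ≡ 252W² = 7(6W)² ≡ 7.
√−3⇒√7 : ∀ {x y K W N} → x * x + + 3 ≡ K * N → y * y + + 84 ≡ N → N ≡ + 6 * W + 1ℤ →
         ∃ λ c → (x * y * W) * (x * y * W) - N * c ≡ + 7
√−3⇒√7 {x} {y} {K} {W} x²+3≡ y²+84≡ refl =
  let N = + 6 * W + 1ℤ
      c = K * (+ 6 * W - + 83) * W * W - + 3 * W * W + + 42 * W - + 7
  in c , (begin
    (x * y * W) * (x * y * W) - N * c                        ≡⟨ solve (x ∷ y ∷ K ∷ W ∷ []) ⟩
    (x * x + + 3 - + 3) * (y * y + + 84 - + 84) * (W * W) - N * c
      ≡⟨ cong₂ (λ u v → (u - + 3) * (v - + 84) * (W * W) - N * c) x²+3≡ y²+84≡ ⟩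
    (K * N - + 3) * (N - + 84) * (W * W) - N * c             ≡⟨ solve (K ∷ W ∷ []) ⟩
    + 7                                                      ∎)

y²+84≡-norm⇒7∣y : ∀ {y p s} → y * y + + 84 ≡ -1ℤ * (p * p - + 7 * (s * s)) → + 7 ∣ y
y²+84≡-norm⇒7∣y {y} {p} {s} eq = 7∣x²+y²⇒7∣x y p (divides (s * s - + 12) (begin
  y * y + p * p                                  ≡⟨ solve (y ∷ p ∷ []) ⟩
  (y * y + + 84) - + 84 + p * p                  ≡⟨ cong (λ z → z - + 84 + p * p) eq ⟩
  -1ℤ * (p * p - + 7 * (s * s)) - + 84 + p * p   ≡⟨ solve (p ∷ s ∷ []) ⟩
  (s * s - + 12) * + 7                           ∎))

3∤6W+1 : ∀ W → ¬ + 3 ∣ + 6 * W + 1ℤ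
3∤6W+1 W 3∣6W+1 =
  from-no (+ 3 ∣? 1ℤ) (subst (+ 3 ∣_) 6W+1-2W·3≡1 (∣m∣n⇒∣m-n 3∣6W+1 (∣n⇒∣m*n (+ 2 * W) ∣-refl)))
  where
  6W+1-2W·3≡1 : + 6 * W + 1ℤ - + 2 * W * + 3 ≡ 1ℤ
  6W+1-2W·3≡1 = solve (W ∷ [])

l²+84≡84+l² : ∀ l → + l * + l + + 84 ≡ + (84 ℕ.+ l ℕ.* l)
l²+84≡84+l² l = begin
  + l * + l + + 84      ≡⟨ cong (_+ + 84) (ℤP.pos-* l l) ⟨
  + (l ℕ.* l) + + 84    ≡⟨ ℤP.pos-+ (l ℕ.* l) 84 ⟨
  + (l ℕ.* l ℕ.+ 84)    ≡⟨ cong +_ (ℕP.+-comm (l ℕ.* l) 84) ⟩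
  + (84 ℕ.+ l ℕ.* l)    ∎

-- NormPair-base multiplies u + v√7 by 2 − √7 (norm −3) and NormPair-step by 11 − 4√7 (norm 9);
-- when a ≡ b (mod 3) the latter leaves a + b√7 unchanged modulo 3.
record NormPair (N t a b : ℤ) : Set where
  field
    norm  : a * a - + 7 * (b * b) ≡ - + 3 * N * (t * t)
    3∣a-b : + 3 ∣ a - b
    3∤b   : ¬ + 3 ∣ b

NormPair-base : ∀ {N u v} → N ≡ u * u - + 7 * (v * v) → ¬ + 3 ∣ N →
                NormPair N 1ℤ (+ 2 * u - + 7 * v) (+ 2 * v - u)
NormPair-base {u = u} {v} refl 3∤N = record
  { norm  = solve (u ∷ v ∷ [])
  ; 3∣a-b = divides (u - + 3 * v) (solve (u ∷ v ∷ []))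
  ; 3∤b   = λ 3∣b → 3∤N (subst (+ 3 ∣_) N≡
              (∣m∣n⇒∣m+n (∣n⇒∣m*n (+ 2 * v - u - + 4 * v) 3∣b) (∣n⇒∣m*n (- (v * v)) ∣-refl)))
  }
  where
  N≡ : (+ 2 * v - u - + 4 * v) * (+ 2 * v - u) + - (v * v) * + 3 ≡ u * u - + 7 * (v * v)
  N≡ = solve (u ∷ v ∷ [])

NormPair-step : ∀ {N t a b} → NormPair N t a b →
                NormPair N (+ 3 * t) (+ 11 * a - + 28 * b) (+ 11 * b - + 4 * a)
NormPair-step {N} {t} {a} {b} np = record
  { norm  = let a' = + 11 * a - + 28 * b; b' = + 11 * b - + 4 * a in begin
      a' * a' - + 7 * (b' * b')           ≡⟨ solve (a ∷ b ∷ []) ⟩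
      + 9 * (a * a - + 7 * (b * b))       ≡⟨ cong (+ 9 *_) norm ⟩
      + 9 * (- + 3 * N * (t * t))         ≡⟨ solve (N ∷ t ∷ []) ⟩
      - + 3 * N * (+ 3 * t * (+ 3 * t))   ∎
  ; 3∣a-b = divides (+ 5 * a - + 13 * b) (solve (a ∷ b ∷ []))
  ; 3∤b   = λ 3∣b' → 3∤b (subst (+ 3 ∣_) b≡
              (∣m∣n⇒∣m-n (∣m∣n⇒∣m+n 3∣b' (∣n⇒∣m*n (+ 4) 3∣a-b)) (∣n⇒∣m*n (+ 2 * b) ∣-refl)))
  }
  where
  open NormPair np
  b≡ : (+ 11 * b - + 4 * a) + + 4 * (a - b) - + 2 * b * + 3 ≡ b
  b≡ = solve (a ∷ b ∷ [])

normPairs : ∀ {N u v} → N ≡ u * u - + 7 * (v * v) → ¬ + 3 ∣ N →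
            ∀ j → ∃₂ λ a b → NormPair N (+ (3 ℕ.^ j)) a b
normPairs {u = u} {v} N≡ 3∤N zero = _ , _ , NormPair-base {u = u} {v} N≡ 3∤N
normPairs {N} {u} {v} N≡ 3∤N (suc j) with normPairs {u = u} {v} N≡ 3∤N j
... | a , b , np = _ , _ , subst (λ t → NormPair N t (+ 11 * a - + 28 * b) (+ 11 * b - + 4 * a))
                                 (sym (ℤP.pos-* 3 (3 ℕ.^ j))) (NormPair-step np)

3∤8b-3a : ∀ {a b} → ¬ + 3 ∣ b → ¬ + 3 ∣ + 8 * b - + 3 * a
3∤8b-3a {a} {b} 3∤b 3∣8b-3a = 3∤b (subst (+ 3 ∣_) b≡ (∣m∣n⇒∣m-n (∣n⇒∣m*n (+ 3 * b - a) ∣-refl) 3∣8b-3a))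
  where
  b≡ : (+ 3 * b - a) * + 3 - (+ 8 * b - + 3 * a) ≡ b
  b≡ = solve (a ∷ b ∷ [])

^-monoʳ-∣ : ∀ a {m n} → m ≤ n → a ℕ.^ m ℕD.∣ a ℕ.^ n
^-monoʳ-∣ a {m} {n} m≤n = ℕD.divides (a ℕ.^ (n ℕ.∸ m)) (begin
  a ℕ.^ n                           ≡⟨ cong (a ℕ.^_) (ℕP.m+[n∸m]≡n m≤n) ⟨
  a ℕ.^ (m ℕ.+ (n ℕ.∸ m))           ≡⟨ ℕP.^-distribˡ-+-* a m (n ℕ.∸ m) ⟩
  a ℕ.^ m ℕ.* a ℕ.^ (n ℕ.∸ m)       ≡⟨ ℕP.*-comm (a ℕ.^ m) _ ⟩
  a ℕ.^ (n ℕ.∸ m) ℕ.* a ℕ.^ m       ∎)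

prime∣prime^⇒≡ : ∀ {p q} n → Prime p → Prime q → p ℕD.∣ q ℕ.^ n → p ≡ q
prime∣prime^⇒≡ zero p-prime _ p∣1 =
  contradiction (ℕD.∣1⇒≡1 p∣1) (ℕ.nonTrivial⇒≢1 {{prime⇒nonTrivial p-prime}})
prime∣prime^⇒≡ {q = q} (suc n) p-prime q-prime p∣qⁿ⁺¹ with euclidsLemma q (q ℕ.^ n) p-prime p∣qⁿ⁺¹
... | inj₂ p∣qⁿ = prime∣prime^⇒≡ n p-prime q-prime p∣qⁿ
... | inj₁ p∣q  = [ (λ p≡1 → contradiction p≡1 (ℕ.nonTrivial⇒≢1 {{prime⇒nonTrivial p-prime}})) , id ]′
                    (prime⇒irreducible q-prime p∣q)

module _ {p q ω : ℕ} (p-prime : Prime p) (q-prime : Prime q) {M : Quad} (x0≡qω : ∣ x0 M ∣ ≡ q ℕ.^ ω) where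

  IsNp-suc⇒p≡q : ∀ {j n} → IsNp p M j (suc n) → p ≡ q
  IsNp-suc⇒p≡q {n = n} ((pⁿ⁺¹∣x0 , _) , _) =
    prime∣prime^⇒≡ ω p-prime q-prime (subst (p ℕD.∣_) x0≡qω (ℕD.∣-trans (ℕD.m∣m*n (p ℕ.^ n)) pⁿ⁺¹∣x0))

  IsNp-coprime : ∀ {j} → ¬ q ℕD.∣ ∣ coord M j ∣ → ∀ n → IsNp p M j n → n ≡ 0
  IsNp-coprime q∤xj zero    _ = refl
  IsNp-coprime {j} q∤xj (suc n) isNp@((_ , pⁿ⁺¹∣xj) , _) with IsNp-suc⇒p≡q {j} {n} isNp
  ... | refl = contradiction (ℕD.∣-trans (ℕD.m∣m*n (p ℕ.^ n)) pⁿ⁺¹∣xj) q∤xj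

  IsNp-exact : ∀ {j} → q ℕ.^ ω ℕD.∣ ∣ coord M j ∣ → ∀ n → IsNp p M j n → n ≡ 0 ⊎ n ≡ ω
  IsNp-exact qω∣xj zero    _ = inj₁ refl
  IsNp-exact {j} qω∣xj (suc n) isNp@((qⁿ⁺¹∣x0 , _) , qⁿ⁺²∤both)
    with IsNp-suc⇒p≡q {j} {n} isNp | ℕP.<-cmp (suc n) ω
  ... | refl | tri< n<ω _ _ =
    contradiction (subst (_ ℕD.∣_) (sym x0≡qω) (^-monoʳ-∣ q n<ω) , ℕD.∣-trans (^-monoʳ-∣ q n<ω) qω∣xj)
                  qⁿ⁺²∤both
  ... | refl | tri≈ _ n≡ω _ = inj₂ n≡ω
  ... | refl | tri> _ _ ω<n = contradiction (subst (_ ℕD.∣_) x0≡qω qⁿ⁺¹∣x0)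
    (ℕD.>⇒∤ {{ℕP.m^n≢0 q ω {{prime⇒nonZero q-prime}}}}
            (ℕP.^-monoʳ-< q (ℕ.nonTrivial⇒n>1 q {{prime⇒nonTrivial q-prime}}) ω<n))

primePower⇒Primitive : ∀ {q ω M} → Prime q → ∣ x0 M ∣ ≡ q ℕ.^ ω → ¬ q ℕD.∣ ∣ x3 M ∣ → Primitive M
primePower⇒Primitive {ω = ω} q-prime x0≡qω q∤x3 p p-prime (p∣x0 , _ , _ , p∣x3)
  with prime∣prime^⇒≡ ω p-prime q-prime (subst (p ℕD.∣_) x0≡qω p∣x0)
... | refl = q∤x3 p∣x3

MultOK-zero : ∀ k ω → MultOK k ω 0
MultOK-zero campana ω = inj₁ refl
MultOK-zero darmon  ω = ω ℕD.∣0

MultOK-refl : ∀ k ω → MultOK k ω ω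
MultOK-refl campana ω = inj₂ ℕP.≤-refl
MultOK-refl darmon  ω = ℕD.∣-refl

LocalOK-n≡0 : ∀ {k p M j} → (∀ n → IsNp p M j n → n ≡ 0) → ∀ w → LocalOK k p M j w
LocalOK-n≡0         n≡0 ∞       = n≡0
LocalOK-n≡0 {k = k} n≡0 (fin ω) n isNp = subst (MultOK k ω) (sym (n≡0 n isNp)) (MultOK-zero k ω)

LocalOK-n≡0∨ω : ∀ {k p M j ω} → (∀ n → IsNp p M j n → n ≡ 0 ⊎ n ≡ ω) → LocalOK k p M j (fin ω)
LocalOK-n≡0∨ω {k = k} {ω = ω} n≡0∨ω n isNp with n≡0∨ω n isNp
... | inj₁ refl = MultOK-zero k ω
... | inj₂ refl = MultOK-refl k ω

LocalOK-transport : ∀ {k p M M' j j'} w → (∀ {n} → IsNp p M' j' n → IsNp p M j n) →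
                    LocalOK k p M j w → LocalOK k p M' j' w
LocalOK-transport ∞       f ok n isNp = ok n (f {n} isNp)
LocalOK-transport (fin ω) f ok n isNp = ok n (f {n} isNp)

prime[3] : Prime 3
prime[3] = from-yes (prime? 3)

-- On the slice u₁ = 16 the surface reads (u₂ − 8u₃)² − 63u₃² = m − 256 = −3(84 + l²);
-- put u₂ − 8u₃ = −a/t and u₃ = b/(3t).
slice-OnX : ∀ {L N a b t} → L * L + + 84 ≡ N → a * a - + 7 * (b * b) ≡ - + 3 * N * (t * t) →
            OnX (+ 4 - + 3 * (L * L)) (quad (+ 3 * t) (+ 16 * (+ 3 * t)) (+ 8 * b - + 3 * a) b)
slice-OnX {L} {a = a} {b} {t} refl norm =
  let m  = + 4 - + 3 * (L * L)
      N  = L * L + + 84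
      x₀ = + 3 * t
      x₂ = + 8 * b - + 3 * a
  in begin
    x₀ * (+ 16 * x₀ * (+ 16 * x₀) + x₂ * x₂ + b * b) - + 16 * x₀ * x₂ * b
      ≡⟨ solve (L ∷ a ∷ b ∷ t ∷ []) ⟩
    m * (x₀ * x₀ * x₀) + + 27 * t * (a * a - + 7 * (b * b) + + 3 * N * (t * t))
      ≡⟨ cong (λ z → m * (x₀ * x₀ * x₀) + + 27 * t * (z + + 3 * N * (t * t))) norm ⟩
    m * (x₀ * x₀ * x₀) + + 27 * t * (- + 3 * N * (t * t) + + 3 * N * (t * t))
      ≡⟨ solve (L ∷ t ∷ []) ⟩
    m * (x₀ * x₀ * x₀) ∎

slicePoint : ∀ {L N a b} j → L * L + + 84 ≡ N → NormPair N (+ (3 ℕ.^ j)) a b → ∀ k ω₂ ω₃ →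
             IsStrictPoint k (+ 4 - + 3 * (L * L)) (fin (suc j) , ω₂ , ω₃)
               (quad (+ (3 ℕ.^ suc j)) (+ (16 ℕ.* 3 ℕ.^ suc j)) (+ 8 * b - + 3 * a) b)
slicePoint {L} {N} {a} {b} j L²+84≡N np k ω₂ ω₃ =
  x0≢0 , primePower⇒Primitive {ω = suc j} {M} prime[3] refl (3∤b ∘ ∣ᵤ⇒∣) , onX , local
  where
  open NormPair np
  M : Quad
  M = quad (+ (3 ℕ.^ suc j)) (+ (16 ℕ.* 3 ℕ.^ suc j)) (+ 8 * b - + 3 * a) b
  x0≢0 : + (3 ℕ.^ suc j) ≢ 0ℤ
  x0≢0 = ℕ.≢-nonZero⁻¹ _ {{ℕP.m^n≢0 3 (suc j)}} ∘ ℤP.+-injective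
  x0≡ : + (3 ℕ.^ suc j) ≡ + 3 * + (3 ℕ.^ j)
  x0≡ = ℤP.pos-* 3 (3 ℕ.^ j)
  x1≡ : + (16 ℕ.* 3 ℕ.^ suc j) ≡ + 16 * (+ 3 * + (3 ℕ.^ j))
  x1≡ = trans (ℤP.pos-* 16 (3 ℕ.^ suc j)) (cong (+ 16 *_) x0≡)
  onX : OnX (+ 4 - + 3 * (L * L)) M
  onX = subst₂ (λ x₀ x₁ → OnX (+ 4 - + 3 * (L * L)) (quad x₀ x₁ (+ 8 * b - + 3 * a) b)) (sym x0≡) (sym x1≡)
          (slice-OnX {L} {N} {a} {b} {+ (3 ℕ.^ j)} L²+84≡N norm)
  local : ∀ p → Prime p → LocalOK k p M 0 (fin (suc j)) × LocalOK k p M 1 ω₂ × LocalOK k p M 2 ω₃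
  local p p-prime =
    LocalOK-n≡0∨ω {M = M} {0} (IsNp-exact {ω = suc j} p-prime prime[3] {M} refl {0} (ℕD.n∣m*n 16)) ,
    LocalOK-n≡0 {M = M} {1} (IsNp-coprime {ω = suc j} p-prime prime[3] {M} refl {1} (3∤8b-3a {a} 3∤b ∘ ∣ᵤ⇒∣)) ω₂ ,
    LocalOK-n≡0 {M = M} {2} (IsNp-coprime {ω = suc j} p-prime prime[3] {M} refl {2} (3∤b ∘ ∣ᵤ⇒∣)) ω₃

swap₁₂ swap₂₃ : Quad → Quad
swap₁₂ (quad a b c d) = quad a c b d
swap₂₃ (quad a b c d) = quad a b d c

IsStrictPoint-swap₁₂ : ∀ {k m ω₁ ω₂ ω₃ M} → IsStrictPoint k m (ω₁ , ω₂ , ω₃) M →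
                       IsStrictPoint k m (ω₂ , ω₁ , ω₃) (swap₁₂ M)
IsStrictPoint-swap₁₂ {ω₁ = ω₁} {ω₂} {ω₃} {quad a b c d} (x0≢0 , prim , onX , local) =
  x0≢0 ,
  (λ p p-prime (p∣a , p∣c , p∣b , p∣d) → prim p p-prime (p∣a , p∣b , p∣c , p∣d)) ,
  trans swapped onX ,
  λ p p-prime → let (ok₁ , ok₂ , ok₃) = local p p-prime in
    LocalOK-transport ω₂ id ok₂ , LocalOK-transport ω₁ id ok₁ , LocalOK-transport ω₃ id ok₃
  where
  swapped : a * (c * c + b * b + d * d) - c * b * d ≡ a * (b * b + c * c + d * d) - b * c * d
  swapped = solve (a ∷ b ∷ c ∷ d ∷ [])

IsStrictPoint-swap₂₃ : ∀ {k m ω₁ ω₂ ω₃ M} → IsStrictPoint k m (ω₁ , ω₂ , ω₃) M →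
                       IsStrictPoint k m (ω₁ , ω₃ , ω₂) (swap₂₃ M)
IsStrictPoint-swap₂₃ {ω₁ = ω₁} {ω₂} {ω₃} {quad a b c d} (x0≢0 , prim , onX , local) =
  x0≢0 ,
  (λ p p-prime (p∣a , p∣b , p∣d , p∣c) → prim p p-prime (p∣a , p∣b , p∣c , p∣d)) ,
  trans swapped onX ,
  λ p p-prime → let (ok₁ , ok₂ , ok₃) = local p p-prime in
    LocalOK-transport ω₁ id ok₁ , LocalOK-transport ω₃ id ok₃ , LocalOK-transport ω₂ id ok₂
  where
  swapped : a * (b * b + d * d + c * c) - b * d * c ≡ a * (b * b + c * c + d * d) - b * c * d
  swapped = solve (a ∷ b ∷ c ∷ d ∷ [])

module _ {l : ℕ} (l-prime : Prime l) (17≤l : 17 ≤ l) where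

  ∤l : ∀ d .{{_ : ℕ.NonTrivial d}} → d ≤ 16 → ¬ d ℕD.∣ l
  ∤l d d≤16 d∣l = Prime.notComposite l-prime (composite (ℕP.≤-trans (s≤s d≤16) 17≤l) d∣l)

  84+l²≡6W+1 : ∃ λ W → + (84 ℕ.+ l ℕ.* l) ≡ + 6 * W + 1ℤ
  84+l²≡6W+1 with coprime6⇒n²≡1[6] l (∤l 2 (ℕP.m≤m+n 2 14)) (∤l 3 (ℕP.m≤m+n 3 13))
  ... | k , l²≡ = + (14 ℕ.+ k) , (begin
    + (84 ℕ.+ l ℕ.* l)            ≡⟨ cong (λ n → + (84 ℕ.+ n)) l²≡ ⟩
    + (84 ℕ.+ (1 ℕ.+ 6 ℕ.* k))    ≡⟨ cong +_ (ℕRing.solve (k ∷ [])) ⟩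
    + (6 ℕ.* (14 ℕ.+ k) ℕ.+ 1)    ≡⟨ ℤP.pos-+ (6 ℕ.* (14 ℕ.+ k)) 1 ⟩
    + (6 ℕ.* (14 ℕ.+ k)) + 1ℤ     ≡⟨ cong (_+ 1ℤ) (ℤP.pos-* 6 (14 ℕ.+ k)) ⟩
    + 6 * + (14 ℕ.+ k) + 1ℤ       ∎)

  84+l²-isNorm : ∀ x → + (84 ℕ.+ l ℕ.* l) ℤD.∣ x * x + + 3 →
                 ∃₂ λ u v → + (84 ℕ.+ l ℕ.* l) ≡ u * u - + 7 * (v * v)
  84+l²-isNorm x N∣x²+3 with ∣ᵤ⇒∣ N∣x²+3 | 84+l²≡6W+1
  ... | divides K x²+3≡ | W , N≡ with √−3⇒√7 {x} {+ l} {K} {W} x²+3≡ (l²+84≡84+l² l) N≡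
  ... | c , disc with det7⇒NormPullback± _ {x * + l * W} {c} disc
  ... | inj₁ (pullback p _ s _ N≡p²-7s² _ _) = p , s , trans N≡p²-7s² (ℤP.*-identityˡ _)
  ... | inj₂ (pullback p _ s _ N≡7s²-p² _ _) =
    contradiction (∣⇒∣ᵤ (y²+84≡-norm⇒7∣y {+ l} {p} {s} (trans (l²+84≡84+l² l) N≡7s²-p²)))
                  (∤l 7 (ℕP.m≤m+n 7 9))

  finiteWeightPoint : ∀ {ω} → AdmissibleWeight ω → IsFinite ω →
                      ∀ x → + (84 ℕ.+ l ℕ.* l) ℤD.∣ x * x + + 3 →
                      ∀ k ω' ω'' → ∃ λ M → IsStrictPoint k (mOf l) (ω , ω' , ω'') M
  finiteWeightPoint (fin-ok {zero} ()) _
  finiteWeightPoint (fin-ok {suc j} _) (is-fin _) x N∣x²+3 k ω' ω'' =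
    let (u , v , N≡u²-7v²) = 84+l²-isNorm x N∣x²+3
        (W , N≡6W+1)       = 84+l²≡6W+1
        (a , b , np)       = normPairs {u = u} {v} N≡u²-7v² (3∤6W+1 W ∘ subst (+ 3 ∣_) N≡6W+1) j
    in _ , slicePoint {+ l} {+ (84 ℕ.+ l ℕ.* l)} {a} {b} j (l²+84≡84+l² l) np k ω' ω''

theorem4p5 : (l : ℕ) → Prime l → 17 ≤ l →
    (ω₁ ω₂ ω₃ : Weight) →
    AdmissibleWeight ω₁ → AdmissibleWeight ω₂ → AdmissibleWeight ω₃ →
    (IsFinite ω₁ ⊎ IsFinite ω₂ ⊎ IsFinite ω₃) →
    (∃ λ (x : ℤ) → (+ (84 ℕ.+ l ℕ.* l)) ℤD.∣ (x ℤ.* x ℤ.+ + 3)) →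
    (k : Kind) →
    ∃ λ (M : Quad) → IsStrictPoint k (mOf l) (ω₁ , ω₂ , ω₃) M
theorem4p5 l l-prime 17≤l ω₁ ω₂ ω₃ adm₁ adm₂ adm₃ someFinite (x , N∣x²+3) k = pick someFinite
  where
  point : ∀ {ω} → AdmissibleWeight ω → IsFinite ω →
          ∀ ω' ω'' → ∃ λ M → IsStrictPoint k (mOf l) (ω , ω' , ω'') M
  point adm finite ω' ω'' = finiteWeightPoint l-prime 17≤l adm finite x N∣x²+3 k ω' ω''
  pick : IsFinite ω₁ ⊎ IsFinite ω₂ ⊎ IsFinite ω₃ → ∃ λ M → IsStrictPoint k (mOf l) (ω₁ , ω₂ , ω₃) M
  pick (inj₁ finite₁)        = point adm₁ finite₁ ω₂ ω₃
  pick (inj₂ (inj₁ finite₂)) =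
    Prod.map swap₁₂ (IsStrictPoint-swap₁₂ {m = mOf l}) (point adm₂ finite₂ ω₁ ω₃)
  pick (inj₂ (inj₂ finite₃)) =
    Prod.map (swap₂₃ ∘ swap₁₂) (IsStrictPoint-swap₂₃ {m = mOf l} ∘ IsStrictPoint-swap₁₂ {m = mOf l})
             (point adm₃ finite₃ ω₁ ω₂)
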